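{- Let $n\in\mathbb{N}$. A Grassmannian permutation $\pi\in S_n$ is biGrassmannian if and only if it avoids the pattern $2413$; that is, $\mathscr{G}_n\cap\mathscr{G}_n^{ -1}=\mathscr{G}_n(2413)$. Moreover, \[ \left|\mathscr{G}_n\cap\mathscr{G}_n^{ -1}\right| = 1+\binom{n+1}{3}. \]
   Context: A permutation $\pi\in S_n$ has a descent at position $i$ if $\pi(i)>\pi(i+1)$. A permutation is Grassmannian if it has at most one descent. $\mathscr{G}_n$ denotes the set of Grassmannian permutations of $[n]=\{1,\dots,n\}$, and $\mathscr{G}_n^{ -1}=\{\pi^{ -1}:\pi\in\mathscr{G}_n\}$. A permutation $\pi$ is biGrassmannian if both $\pi$ and $\pi^{ -1}$ are Grassmannian. For a pattern $\sigma$, $\mathscr{G}_n(\sigma)$ is the set of permutations in $\mathscr{G}_n$ avoiding $\sigma$ in the classical sense (no subsequence order-isomorphic to $\sigma$). -}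

module Defs where

open import Data.Nat using (ℕ; zero; suc; _+_; _<_; _≤_; _<ᵇ_; _≤?_)
open import Data.Bool using (if_then_else_)
open import Data.Fin as F using (Fin; toℕ)
open import Data.Maybe using (Maybe; just; nothing; fromMaybe)
import Data.Maybe
open import Data.List as L using (List; []; _∷_; [_]; concatMap)
open import Data.Vec as V using (Vec; []; _∷_; lookup; tabulate; toList)
open import Data.Product using (_×_; ∃-syntax; _,_)
open import Data.List.Relation.Unary.Unique.Propositional using (Unique)
import Data.List.Relation.Unary.Unique.DecPropositional as UDec
open import Relation.Binary.PropositionalEquality using (_≡_)
open import Relation.Nullary using (Dec; yes; no)
open import Data.Empty using (⊥)
open import Relation.Nullary.Decidable using (_×-dec_)

-- A permutation of [n] = {1..n} is represented in one-line notation as a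
-- vector  π(1) … π(n)  of length n over Fin n (values 0..n-1 stand for 1..n).
IsPerm : ∀ {n} → Vec (Fin n) n → Set
IsPerm v = Unique (toList v)

isPerm? : ∀ {n} (v : Vec (Fin n) n) → Dec (IsPerm v)
isPerm? {n} v = UDec.unique? F._≟_ (toList v)

descentsℕ : List ℕ → ℕ
descentsℕ []           = 0
descentsℕ (x ∷ [])     = 0
descentsℕ (x ∷ y ∷ xs) = (if y <ᵇ x then 1 else 0) + descentsℕ (y ∷ xs)

descents : ∀ {n k} → Vec (Fin n) k → ℕ
descents v = descentsℕ (L.map toℕ (toList v))

IsGrassmannian : ∀ {n} → Vec (Fin n) n → Set
IsGrassmannian v = descents v ≤ 1

position : ∀ {n k} → Vec (Fin n) k → Fin n → Maybe (Fin k)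
position []       j = nothing
position (x ∷ xs) j with x F.≟ j
... | yes _ = just F.zero
... | no  _ = Data.Maybe.map F.suc (position xs j)

-- inverse permutation in one-line notation: π⁻¹(j) = the position of j in π
-- (for a genuine permutation every value occurs exactly once, so the
-- default value is never used)
inverse : ∀ {n} → Vec (Fin n) n → Vec (Fin n) n
inverse v = tabulate (λ j → fromMaybe j (position v j))

IsBiGrassmannian : ∀ {n} → Vec (Fin n) n → Set
IsBiGrassmannian v = IsGrassmannian v × IsGrassmannian (inverse v)

IsPermBiGrassmannian : ∀ {n} → Vec (Fin n) n → Set
IsPermBiGrassmannian v = IsPerm v × IsBiGrassmannian v

isPermBiGrassmannian? : ∀ {n} (v : Vec (Fin n) n) → Dec (IsPermBiGrassmannian v)
isPermBiGrassmannian? v =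
  isPerm? v ×-dec ((descents v ≤? 1) ×-dec (descents (inverse v) ≤? 1))

Contains2413 : ∀ {n} → Vec (Fin n) n → Set
Contains2413 {n} v =
  ∃[ i ] ∃[ j ] ∃[ k ] ∃[ l ]
    (i F.< j × j F.< k × k F.< l ×
     lookup v k F.< lookup v i × lookup v i F.< lookup v l × lookup v l F.< lookup v j)

Avoids2413 : ∀ {n} → Vec (Fin n) n → Set
Avoids2413 v = Contains2413 v → ⊥

allWords : ∀ {A : Set} → List A → (k : ℕ) → List (Vec A k)
allWords xs zero    = [ [] ]
allWords xs (suc k) = concatMap (λ x → L.map (x ∷_) (allWords xs k)) xs

allVecs : (n : ℕ) → List (Vec (Fin n) n)
allVecs n = allWords (L.allFin n) n

-- A permutation f of [0, n) with a single descent d ascends everywhere else. If f⁻¹ descends at v,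
-- the positions f⁻¹(v + 1) < f⁻¹(v) carry the values v + 1 > v, so f descends between them, i.e.
-- f⁻¹(v + 1) ≤ d < f⁻¹(v). Two descents v < w of f⁻¹ therefore give positions
-- f⁻¹(v + 1) < f⁻¹(w + 1) ≤ d < f⁻¹(v) < f⁻¹(w) carrying a 2413 pattern; conversely a 2413 pattern at
-- i < j < k < l forces descents of f⁻¹ in the disjoint value ranges [f k, f i) and [f l, f j).
--
-- When f and f⁻¹ both have one descent, at d and v, f fixes every point below f⁻¹(v + 1) and above
-- f⁻¹(v), and translates the stretches [f⁻¹(v + 1), d] and [d + 1, f⁻¹(v)]: an ascending stretch of f
-- on whose image f⁻¹ also ascends is mapped by a translation. So f is the identity or exchanges two
-- adjacent nonempty blocks, and such exchanges correspond to the C(n + 1, 3) triples (a, b, c) with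
-- a + (b + 1) + (c + 1) ≤ n.

module Submission where

open import Defs
open import Data.Nat using (ℕ; zero; suc; pred; _+_; _∸_; _<_; _≤_; z≤n; s≤s; z<s; _≟_; _<?_; _≤?_; _<ᵇ_)
open import Data.Nat.Properties
open import Data.Nat.Combinatorics using (_C_; nCk+nC[k+1]≡[n+1]C[k+1]; nC1≡n)
open import Data.Bool using (true; false; if_then_else_)
open import Data.Fin as F using (Fin; toℕ; fromℕ<)
import Data.Fin.Properties as FP
open import Data.Maybe using (just; nothing; fromMaybe)
open import Data.List using (List; []; _∷_; _++_; map; upTo; length; filter; concatMap; cartesianProductWith)
open import Data.List.Properties using (length-++; length-map; length-upTo)
open import Data.List.Membership.Propositional using (_∈_)
open import Data.List.Membership.Propositional.Properties
open import Data.List.Membership.Propositional.Properties.WithK using (unique∧set⇒bag)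
open import Data.List.Relation.Unary.Any using (here; there)
open import Data.List.Relation.Unary.All as All using (All; []; _∷_)
import Data.List.Relation.Unary.All.Properties as All
open import Data.List.Relation.Unary.AllPairs using ([]; _∷_)
open import Data.List.Relation.Unary.Unique.Propositional using (Unique)
import Data.List.Relation.Unary.Unique.Propositional.Properties as Unique
open import Data.List.Relation.Binary.BagAndSetEquality using (∼bag⇒↭)
open import Data.List.Relation.Binary.Permutation.Propositional.Properties using (↭-length)
open import Data.Vec using (Vec; []; _∷_; lookup; tabulate; toList)
import Data.Vec.Properties as VP
open import Data.Product using (_×_; _,_; proj₁; proj₂; map₁; ∃-syntax)
open import Data.Sum using (_⊎_; inj₁; inj₂)
open import Data.Empty using (⊥; ⊥-elim)
open import Relation.Nullary using (¬_; Dec; yes; no; contradiction)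
open import Relation.Nullary.Decidable using (_×-dec_)
open import Relation.Binary.Definitions using (tri<; tri≈; tri>)
open import Relation.Binary.PropositionalEquality
open import Function using (id; _∘_)
open import Function.Bundles using (_⇔_; mk⇔; Equivalence)
open import Function.Properties.Equivalence using () renaming (sym to ⇔-sym; trans to ⇔-trans)
open import Function.Related.TypeIsomorphisms using (¬-cong-⇔)
open import Algebra.Properties.CommutativeSemigroup +-commutativeSemigroup using (xy∙z≈xz∙y)

-- Descents and ascending stretches of functions on ℕ

Descent : (ℕ → ℕ) → ℕ → Set
Descent h i = h (suc i) < h i

AtMostOneDescent : (ℕ → ℕ) → ℕ → Set
AtMostOneDescent h n = ∀ {i j} → i < j → suc j < n → Descent h i → Descent h j → ⊥

Ascending : (ℕ → ℕ) → ℕ → ℕ → Set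
Ascending h p q = ∀ {e} → p ≤ e → e < q → h e < h (suc e)

AgreeBelow : ℕ → (ℕ → ℕ) → (ℕ → ℕ) → Set
AgreeBelow n f g = ∀ {p} → p < n → f p ≡ g p

AtMostOneDescent-cong : ∀ {n h k} → AgreeBelow n h k → AtMostOneDescent h n → AtMostOneDescent k n
AtMostOneDescent-cong {h = h} {k} h≗k one {i} {j} i<j sj<n desci descj =
  one i<j sj<n (agree-descent (≤-<-trans i<j (<-trans (n<1+n j) sj<n)) desci) (agree-descent sj<n descj)
  where
  agree-descent : ∀ {e} → suc e < _ → Descent k e → Descent h e
  agree-descent {e} se<n = subst₂ _<_ (sym (h≗k se<n)) (sym (h≗k (<-trans (n<1+n e) se<n)))

module _ {h : ℕ → ℕ} where

  descent-unique : ∀ {n i j} → AtMostOneDescent h n → suc i < n → suc j < n →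
                   Descent h i → Descent h j → i ≡ j
  descent-unique {i = i} {j} one si<n sj<n di dj with <-cmp i j
  ... | tri< i<j _ _ = ⊥-elim (one i<j sj<n di dj)
  ... | tri≈ _ i≡j _ = i≡j
  ... | tri> _ _ j<i = ⊥-elim (one j<i si<n dj di)

  descent-between : ∀ {p q} → p < q → h q < h p → ∃[ d ] p ≤ d × d < q × Descent h d
  descent-between {p} {suc q} (s≤s p≤q) hq<hp with h (suc q) <? h q
  ... | yes desc = q , p≤q , ≤-refl , desc
  ... | no ¬d with m≤n⇒m<n∨m≡n p≤q
  ...   | inj₂ refl = ⊥-elim (¬d hq<hp)
  ...   | inj₁ p<q with descent-between p<q (≤-<-trans (≮⇒≥ ¬d) hq<hp)
  ...     | d , p≤d , d<q , desc = d , p≤d , m<n⇒m<1+n d<q , desc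

  ascending-+ : ∀ {p} k → Ascending h p (p + k) → h p + k ≤ h (p + k)
  ascending-+ {p} zero asc rewrite +-identityʳ p | +-identityʳ (h p) = ≤-refl
  ascending-+ {p} (suc k) asc rewrite +-suc p k | +-suc (h p) k =
    ≤-<-trans (ascending-+ k λ p≤e e<p+k → asc p≤e (m<n⇒m<1+n e<p+k))
              (asc (m≤m+n p k) ≤-refl)

  ascending-∸ : ∀ {p q} → p ≤ q → Ascending h p q → h p + (q ∸ p) ≤ h q
  ascending-∸ {p} p≤q asc with m≤n⇒∃[o]m+o≡n p≤q
  ... | k , refl rewrite m+n∸m≡n p k = ascending-+ k asc

  ascending-mono : ∀ {p q} → p ≤ q → Ascending h p q → h p ≤ h q
  ascending-mono p≤q asc = ≤-trans (m≤m+n _ _) (ascending-∸ p≤q asc)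

  ascending-strict : ∀ {p q} → p < q → Ascending h p q → h p < h q
  ascending-strict p<q asc =
    <-≤-trans (asc ≤-refl p<q) (ascending-mono p<q λ p<e e<q → asc (<⇒≤ p<e) e<q)

  ascending-reflects-< : ∀ {p q x y} → Ascending h p q → p ≤ y → x ≤ q → h x < h y → x < y
  ascending-reflects-< {x = x} {y} asc p≤y x≤q hx<hy with <-cmp x y
  ... | tri< x<y _ _ = x<y
  ... | tri≈ _ refl _ = ⊥-elim (<-irrefl refl hx<hy)
  ... | tri> _ _ y<x = ⊥-elim (<-asym hx<hy
          (ascending-strict y<x λ y≤e e<x → asc (≤-trans p≤y y≤e) (<-≤-trans e<x x≤q)))

  ascending-⊆ : ∀ {p q p′ q′} → p ≤ p′ → q′ ≤ q → Ascending h p q → Ascending h p′ q′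
  ascending-⊆ p≤p′ q′≤q asc p′≤e e<q′ = asc (≤-trans p≤p′ p′≤e) (<-≤-trans e<q′ q′≤q)

  ascending-from-0 : ∀ {k} → Ascending h 0 k → k ≤ h k
  ascending-from-0 {k} asc = ≤-trans (m≤n+m k (h 0)) (ascending-∸ z≤n asc)

  ascending-to-top : ∀ {k l} → k ≤ l → h l ≤ l → Ascending h k l → h k ≤ k
  ascending-to-top {k} {l} k≤l hl≤l asc = +-cancelʳ-≤ (l ∸ k) (h k) k (begin
    h k + (l ∸ k)   ≤⟨ ascending-∸ k≤l asc ⟩
    h l             ≤⟨ hl≤l ⟩
    l               ≡⟨ m+[n∸m]≡n k≤l ⟨
    k + (l ∸ k)     ∎)
    where open ≤-Reasoning

-- Mutually inverse functions on [0, n)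

pred<n : ∀ {k n} → k < n → pred n < n
pred<n (s≤s _) = ≤-refl

<pred⇒suc< : ∀ {e n} → e < pred n → suc e < n
<pred⇒suc< {n = suc _} = s≤s

record Inverses (n : ℕ) (f g : ℕ → ℕ) : Set where
  field
    f-< : ∀ {i} → i < n → f i < n
    g-< : ∀ {j} → j < n → g j < n
    f∘g : ∀ {j} → j < n → f (g j) ≡ j
    g∘f : ∀ {i} → i < n → g (f i) ≡ i

Inverses-sym : ∀ {n f g} → Inverses n f g → Inverses n g f
Inverses-sym inv = record { f-< = g-< ; g-< = f-< ; f∘g = g∘f ; g∘f = f∘g }
  where open Inverses inv

module _ {n : ℕ} {f g : ℕ → ℕ} (inv : Inverses n f g) where
  open Inverses inv

  f-injective : ∀ {i j} → i < n → j < n → f i ≡ f j → i ≡ j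
  f-injective {i} {j} i<n j<n fi≡fj = begin
    i         ≡⟨ g∘f i<n ⟨
    g (f i)   ≡⟨ cong g fi≡fj ⟩
    g (f j)   ≡⟨ g∘f j<n ⟩
    j         ∎
    where open ≡-Reasoning

  inverse-descent : ∀ {p q} → p < q → q < n → f q < f p → ∃[ v ] f q ≤ v × v < f p × Descent g v
  inverse-descent {p} {q} p<q q<n fq<fp =
    descent-between fq<fp (subst₂ _<_ (sym (g∘f (<-trans p<q q<n))) (sym (g∘f q<n)) p<q)

  translation : ∀ {p} k → p + k < n → Ascending f p (p + k) → Ascending g (f p) (f (p + k)) →
                f (p + k) ≡ f p + k
  translation {p} k p+k<n ascf ascg = ≤-antisym upper (ascending-+ k ascf)
    where
    p<n : p < n
    p<n = ≤-<-trans (m≤m+n p k) p+k<n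
    fp≤ : f p ≤ f (p + k)
    fp≤ = ascending-mono (m≤m+n p k) ascf
    gap : p + (f (p + k) ∸ f p) ≤ p + k
    gap = subst₂ _≤_ (cong (_+ _) (g∘f p<n)) (g∘f p+k<n) (ascending-∸ fp≤ ascg)
    upper : f (p + k) ≤ f p + k
    upper = subst (_≤ f p + k) (m+[n∸m]≡n fp≤) (+-monoʳ-≤ (f p) (+-cancelˡ-≤ p _ _ gap))

  ascent-unless-descent : ∀ {e} → suc e < n → ¬ Descent f e → f e < f (suc e)
  ascent-unless-descent {e} se<n ¬desc =
    ≤∧≢⇒< (≮⇒≥ ¬desc) λ fe≡fse → <⇒≢ (n<1+n e) (f-injective (<⇒≤ se<n) se<n fe≡fse)

  prefix-fixed : ∀ {k} → k < n → Ascending f 0 k → Ascending g 0 (f k) → f k ≡ k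
  prefix-fixed k<n ascf ascg =
    ≤-antisym (subst (_ ≤_) (g∘f k<n) (ascending-from-0 ascg)) (ascending-from-0 ascf)

  suffix-fixed : ∀ {k} → k < n → Ascending f k (pred n) → Ascending g (f k) (pred n) → f k ≡ k
  suffix-fixed k<n ascf ascg = ≤-antisym
    (ascending-to-top (<⇒≤pred k<n) (<⇒≤pred (f-< (pred<n k<n))) ascf)
    (subst (_≤ _) (g∘f k<n) (ascending-to-top (<⇒≤pred (f-< k<n)) (<⇒≤pred (g-< (pred<n k<n))) ascg))

  ascending⇒identity : Ascending f 0 (pred n) → ∀ {p} → p < n → f p ≡ p
  ascending⇒identity asc p<n = ≤-antisym
    (ascending-to-top (<⇒≤pred p<n) (<⇒≤pred (f-< (pred<n p<n))) (ascending-⊆ z≤n ≤-refl asc))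
    (ascending-from-0 (ascending-⊆ ≤-refl (<⇒≤pred p<n) asc))

  module WithDescent (one : AtMostOneDescent f n) {d} (sd<n : suc d < n) (desc : Descent f d) where

    ascent-off-descent : ∀ {e} → e ≢ d → suc e < n → f e < f (suc e)
    ascent-off-descent e≢d se<n =
      ascent-unless-descent se<n λ desc′ → e≢d (descent-unique one se<n sd<n desc′ desc)

    ascending-before : ∀ {p q} → q ≤ d → Ascending f p q
    ascending-before q≤d _ e<q = ascent-off-descent (<⇒≢ e<d) (<-trans (s≤s e<d) sd<n)
      where e<d = <-≤-trans e<q q≤d

    ascending-after : ∀ {p q} → d < p → q < n → Ascending f p q
    ascending-after d<p q<n p≤e e<q = ascent-off-descent (>⇒≢ (<-≤-trans d<p p≤e)) (≤-<-trans e<q q<n)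

    descent-straddles : ∀ {v} → suc v < n → Descent g v → g (suc v) ≤ d × d < g v
    descent-straddles {v} sv<n descg =
      straddle (descent-between descg (subst₂ _<_ (sym (f∘g v<n)) (sym (f∘g sv<n)) (n<1+n v)))
      where
      v<n = <-trans (n<1+n v) sv<n
      straddle : ∃[ d′ ] g (suc v) ≤ d′ × d′ < g v × Descent f d′ → g (suc v) ≤ d × d < g v
      straddle (d′ , gsv≤d′ , d′<gv , desc′)
        with refl ← descent-unique one (≤-<-trans d′<gv (g-< v<n)) sd<n desc′ desc = gsv≤d′ , d′<gv

-- The pattern 2413

Pattern2413 : (ℕ → ℕ) → ℕ → Set
Pattern2413 f n = ∃[ i ] ∃[ j ] ∃[ k ] ∃[ l ]
  i < j × j < k × k < l × l < n × f k < f i × f i < f l × f l < f j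

module _ {n f g} (inv : Inverses n f g) where
  open Inverses inv

  pattern2413⇒two-inverse-descents : Pattern2413 f n → ¬ AtMostOneDescent g n
  pattern2413⇒two-inverse-descents (i , j , k , l , i<j , j<k , k<l , l<n , fk<fi , fi<fl , fl<fj) one
    with v₁ , _ , v₁<fi , desc₁ ← inverse-descent inv (<-trans i<j j<k) (<-trans k<l l<n) fk<fi
       | v₂ , fl≤v₂ , v₂<fj , desc₂ ← inverse-descent inv (<-trans j<k k<l) l<n fl<fj
    = one (<-≤-trans (<-trans v₁<fi fi<fl) fl≤v₂) (≤-<-trans v₂<fj (f-< (<-trans j<k (<-trans k<l l<n))))
          desc₁ desc₂

  two-inverse-descents⇒pattern2413 : AtMostOneDescent f n → ∀ {v w} → v < w → suc w < n →
                                     Descent g v → Descent g w → Pattern2413 f n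
  two-inverse-descents⇒pattern2413 one {v} {w} v<w sw<n descv descw =
    pattern-at (inverse-descent (Inverses-sym inv) (n<1+n v) sv<n descv)
    where
    w<n = <-trans (n<1+n w) sw<n
    v<n = <-trans v<w w<n
    sv<n = ≤-<-trans v<w w<n
    pattern-at : ∃[ d ] g (suc v) ≤ d × d < g v × Descent f d → Pattern2413 f n
    pattern-at (d , _ , d<gv , descf) =
      g (suc v) , g (suc w) , g v , g w
      , ascending-reflects-< (ascending-before ≤-refl) z≤n gsv≤d (f∘g-< sv<n sw<n (s≤s v<w))
      , ≤-<-trans gsw≤d d<gv
      , ascending-reflects-< (ascending-after ≤-refl (g-< v<n)) d<gw ≤-refl (f∘g-< v<n w<n v<w)
      , g-< w<n
      , f∘g-< v<n sv<n (n<1+n v)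
      , f∘g-< sv<n w<n (≤∧≢⇒< v<w sv≢w)
      , f∘g-< w<n sw<n (n<1+n w)
      where
      open WithDescent inv one (≤-<-trans d<gv (g-< v<n)) descf
      gsv≤d = proj₁ (descent-straddles sv<n descv)
      gsw≤d = proj₁ (descent-straddles sw<n descw)
      d<gw = proj₂ (descent-straddles sw<n descw)
      f∘g-< : ∀ {x y} → x < n → y < n → x < y → f (g x) < f (g y)
      f∘g-< x<n y<n = subst₂ _<_ (sym (f∘g x<n)) (sym (f∘g y<n))
      sv≢w : suc v ≢ w
      sv≢w refl = <-irrefl refl (≤-<-trans gsv≤d d<gw)

  one-descent⁻¹⇔avoids2413 : AtMostOneDescent f n → AtMostOneDescent g n ⇔ (¬ Pattern2413 f n)
  one-descent⁻¹⇔avoids2413 one = mk⇔ to from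
    where
    to : AtMostOneDescent g n → ¬ Pattern2413 f n
    to oneg pat = pattern2413⇒two-inverse-descents pat oneg
    from : ¬ Pattern2413 f n → AtMostOneDescent g n
    from avoid v<w sw<n descv descw = avoid (two-inverse-descents⇒pattern2413 one v<w sw<n descv descw)

-- Block swaps

<⇒<ᵇ≡true : ∀ {m n} → m < n → (m <ᵇ n) ≡ true
<⇒<ᵇ≡true {zero} {suc n} _ = refl
<⇒<ᵇ≡true {suc m} {suc n} (s≤s m<n) = <⇒<ᵇ≡true m<n

≤⇒<ᵇ≡false : ∀ {m n} → n ≤ m → (m <ᵇ n) ≡ false
≤⇒<ᵇ≡false {m} {zero} _ = refl
≤⇒<ᵇ≡false {suc m} {suc n} (s≤s n≤m) = ≤⇒<ᵇ≡false n≤m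

-- Exchanges the adjacent blocks [a, a + b] and [a + b + 1, a + b + 1 + c].
blockSwap : ℕ → ℕ → ℕ → ℕ → ℕ
blockSwap a b c p =
  if p <ᵇ a then p
  else if p <ᵇ a + suc b then p + suc c
  else if p <ᵇ a + suc b + suc c then p ∸ suc b
  else p

module _ {a b c : ℕ} where

  private
    a≤a+sb : a ≤ a + suc b
    a≤a+sb = m≤m+n a (suc b)
    a+sb≤top : a + suc b ≤ a + suc b + suc c
    a+sb≤top = m≤m+n (a + suc b) (suc c)

  blockSwap-below : ∀ {p} → p < a → blockSwap a b c p ≡ p
  blockSwap-below p<a rewrite <⇒<ᵇ≡true p<a = refl

  blockSwap-first : ∀ {i} → i ≤ b → blockSwap a b c (a + i) ≡ a + i + suc c
  blockSwap-first {i} i≤b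
    rewrite ≤⇒<ᵇ≡false (m≤m+n a i) | <⇒<ᵇ≡true (+-monoʳ-< a (s≤s i≤b)) = refl

  blockSwap-second : ∀ {j} → j ≤ c → blockSwap a b c (a + suc b + j) ≡ a + j
  blockSwap-second {j} j≤c
    rewrite ≤⇒<ᵇ≡false (≤-trans a≤a+sb (m≤m+n (a + suc b) j))
          | ≤⇒<ᵇ≡false (m≤m+n (a + suc b) j)
          | <⇒<ᵇ≡true (+-monoʳ-< (a + suc b) (s≤s j≤c))
          | xy∙z≈xz∙y a (suc b) j = m+n∸n≡m (a + j) (suc b)

  blockSwap-above : ∀ {p} → a + suc b + suc c ≤ p → blockSwap a b c p ≡ p
  blockSwap-above top≤p
    rewrite ≤⇒<ᵇ≡false (≤-trans (≤-trans a≤a+sb a+sb≤top) top≤p)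
          | ≤⇒<ᵇ≡false (≤-trans a+sb≤top top≤p)
          | ≤⇒<ᵇ≡false top≤p = refl

  data Region : ℕ → Set where
    below  : ∀ {p} → p < a → Region p
    first  : ∀ {i} → i ≤ b → Region (a + i)
    second : ∀ {j} → j ≤ c → Region (a + suc b + j)
    above  : ∀ {p} → a + suc b + suc c ≤ p → Region p

  region : ∀ p → Region p
  region p with p <? a
  ... | yes p<a = below p<a
  ... | no p≮a with i , refl ← m≤n⇒∃[o]m+o≡n (≮⇒≥ p≮a) with i ≤? b
  ...   | yes i≤b = first i≤b
  ...   | no i≰b with j , refl ← m≤n⇒∃[o]m+o≡n (≰⇒> i≰b) with j ≤? c
  ...     | yes j≤c = subst Region (+-assoc a (suc b) j) (second j≤c)
  ...     | no j≰c =
    above (subst (a + suc b + suc c ≤_) (+-assoc a (suc b) j) (+-monoʳ-≤ (a + suc b) (≰⇒> j≰c)))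

blockSwap-inverse : ∀ {a b c} p → blockSwap a c b (blockSwap a b c p) ≡ p
blockSwap-inverse {a} {b} {c} p with region {a} {b} {c} p
... | below p<a rewrite blockSwap-below {a} {b} {c} p<a = blockSwap-below p<a
... | first {i} i≤b rewrite blockSwap-first {a} {b} {c} i≤b | xy∙z≈xz∙y a i (suc c) = blockSwap-second i≤b
... | second {j} j≤c rewrite blockSwap-second {a} {b} {c} j≤c =
  trans (blockSwap-first j≤c) (xy∙z≈xz∙y a j (suc b))
... | above top≤p rewrite blockSwap-above {a} {b} {c} top≤p =
  blockSwap-above (subst (_≤ p) (xy∙z≈xz∙y a (suc b) (suc c)) top≤p)

blockSwap-< : ∀ {a b c n p} → a + suc b + suc c ≤ n → p < n → blockSwap a b c p < n
blockSwap-< {a} {b} {c} {n} {p} top≤n p<n with region {a} {b} {c} p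
... | below p<a rewrite blockSwap-below {a} {b} {c} p<a = p<n
... | first {i} i≤b rewrite blockSwap-first {a} {b} {c} i≤b =
  <-≤-trans (+-monoˡ-< (suc c) (+-monoʳ-< a (s≤s i≤b))) top≤n
... | second {j} j≤c rewrite blockSwap-second {a} {b} {c} j≤c =
  <-≤-trans (+-monoʳ-< a (s≤s j≤c))
            (≤-trans (m≤m+n (a + suc c) (suc b)) (subst (_≤ n) (xy∙z≈xz∙y a (suc b) (suc c)) top≤n))
... | above top≤p rewrite blockSwap-above {a} {b} {c} top≤p = p<n

blockSwap-inverses : ∀ {a b c n} → a + suc b + suc c ≤ n → Inverses n (blockSwap a b c) (blockSwap a c b)
blockSwap-inverses {a} {b} {c} {n} top≤n = record
  { f-< = blockSwap-< top≤n
  ; g-< = blockSwap-< (subst (_≤ n) (xy∙z≈xz∙y a (suc b) (suc c)) top≤n)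
  ; f∘g = λ {j} _ → blockSwap-inverse {a} {c} {b} j
  ; g∘f = λ {i} _ → blockSwap-inverse {a} {b} {c} i
  }

blockSwap-≥ : ∀ {a b c p} → p < a + suc b → p ≤ blockSwap a b c p
blockSwap-≥ {a} {b} {c} {p} p<a+sb with region {a} {b} {c} p
... | below p<a = ≤-reflexive (sym (blockSwap-below p<a))
... | first {i} i≤b = ≤-trans (m≤m+n (a + i) (suc c)) (≤-reflexive (sym (blockSwap-first i≤b)))
... | second {j} j≤c = ⊥-elim (m+n≮m (a + suc b) j p<a+sb)
... | above top≤p = ≤-reflexive (sym (blockSwap-above top≤p))

blockSwap-ascent : ∀ {a b c e} → e ≢ a + b → blockSwap a b c e ≤ blockSwap a b c (suc e)
blockSwap-ascent {a} {b} {c} {e} e≢a+b with region {a} {b} {c} e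
... | below e<a = begin
  blockSwap a b c e         ≡⟨ blockSwap-below e<a ⟩
  e                         ≤⟨ n≤1+n e ⟩
  suc e                     ≤⟨ blockSwap-≥ {a} {b} {c} (≤-<-trans e<a (m<m+n a z<s)) ⟩
  blockSwap a b c (suc e)   ∎
  where open ≤-Reasoning
... | first {i} i≤b = begin
  blockSwap a b c (a + i)        ≡⟨ blockSwap-first i≤b ⟩
  a + i + suc c                  ≤⟨ +-monoˡ-≤ (suc c) (+-monoʳ-≤ a (n≤1+n i)) ⟩
  a + suc i + suc c              ≡⟨ blockSwap-first i<b ⟨
  blockSwap a b c (a + suc i)    ≡⟨ cong (blockSwap a b c) (+-suc a i) ⟩
  blockSwap a b c (suc (a + i))  ∎
  where
  open ≤-Reasoning
  i<b = ≤∧≢⇒< i≤b (e≢a+b ∘ cong (a +_))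
... | second {j} j≤c with m≤n⇒m<n∨m≡n j≤c
...   | inj₁ j<c = begin
  blockSwap a b c (a + suc b + j)        ≡⟨ blockSwap-second j≤c ⟩
  a + j                                  ≤⟨ +-monoʳ-≤ a (n≤1+n j) ⟩
  a + suc j                              ≡⟨ blockSwap-second j<c ⟨
  blockSwap a b c (a + suc b + suc j)    ≡⟨ cong (blockSwap a b c) (+-suc (a + suc b) j) ⟩
  blockSwap a b c (suc (a + suc b + j))  ∎
  where open ≤-Reasoning
...   | inj₂ refl = begin
  blockSwap a b c (a + suc b + j)        ≡⟨ blockSwap-second j≤c ⟩
  a + j                                  ≤⟨ +-monoˡ-≤ j (m≤m+n a (suc b)) ⟩
  a + suc b + j                          ≤⟨ n≤1+n _ ⟩
  suc (a + suc b + j)                    ≡⟨ blockSwap-above (≤-reflexive (+-suc (a + suc b) j)) ⟨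
  blockSwap a b c (suc (a + suc b + j))  ∎
  where open ≤-Reasoning
blockSwap-ascent {a} {b} {c} {e} _ | above top≤e = begin
  blockSwap a b c e          ≡⟨ blockSwap-above top≤e ⟩
  e                          ≤⟨ n≤1+n e ⟩
  suc e                      ≡⟨ blockSwap-above (m≤n⇒m≤1+n top≤e) ⟨
  blockSwap a b c (suc e)    ∎
  where open ≤-Reasoning

blockSwap-one-descent : ∀ {a b c n} → AtMostOneDescent (blockSwap a b c) n
blockSwap-one-descent {a} {b} {c} i<j _ desci descj = <-irrefl (trans (at-a+b desci) (sym (at-a+b descj))) i<j
  where
  at-a+b : ∀ {e} → Descent (blockSwap a b c) e → e ≡ a + b
  at-a+b {e} desc with e ≟ a + b
  ... | yes e≡a+b = e≡a+b
  ... | no e≢a+b = ⊥-elim (≤⇒≯ (blockSwap-ascent {a} {b} {c} e≢a+b) desc)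

blockSwap-start : ∀ {a b c} → blockSwap a b c a ≡ a + suc c
blockSwap-start {a} {b} {c} = subst (λ x → blockSwap a b c x ≡ x + suc c) (+-identityʳ a) (blockSwap-first z≤n)

blockSwap-moves-start : ∀ {a b c} → blockSwap a b c a ≢ a
blockSwap-moves-start {a} eq = m+1+n≢m a (trans (sym blockSwap-start) eq)

blockSwap-second-start : ∀ {a b c} → blockSwap a b c (a + suc b) ≡ a
blockSwap-second-start {a} {b} {c} =
  subst (λ x → blockSwap a b c x ≡ a) (+-identityʳ (a + suc b)) (trans (blockSwap-second z≤n) (+-identityʳ a))

start<n : ∀ {n a b c} → a + suc b + suc c ≤ n → a < n
start<n {n} {a} {b} {c} top≤n = <-≤-trans (m<m+n a z<s) (≤-trans (m≤m+n (a + suc b) (suc c)) top≤n)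

second<n : ∀ {n a b c} → a + suc b + suc c ≤ n → a + suc b < n
second<n {n} {a} {b} {c} top≤n = <-≤-trans (m<m+n (a + suc b) z<s) top≤n

blockSwap-agree⇒start-≤ : ∀ {n a b c a′ b′ c′} → a + suc b + suc c ≤ n →
                          AgreeBelow n (blockSwap a b c) (blockSwap a′ b′ c′) → a′ ≤ a
blockSwap-agree⇒start-≤ {a = a} {b} {c} top≤n agree = ≮⇒≥ λ a<a′ →
  blockSwap-moves-start {a} {b} {c} (trans (agree (start<n top≤n)) (blockSwap-below a<a′))

blockSwap-agree⇒left-≤ : ∀ {n a b b′ c} → a + suc b + suc c ≤ n →
                         AgreeBelow n (blockSwap a b c) (blockSwap a b′ c) → b′ ≤ b
blockSwap-agree⇒left-≤ {a = a} {b} {b′} {c} top≤n agree = ≮⇒≥ λ b<b′ →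
  m+1+n≢m a (begin
    a + suc (b + suc c)          ≡⟨ +-assoc a (suc b) (suc c) ⟨
    a + suc b + suc c            ≡⟨ blockSwap-first b<b′ ⟨
    blockSwap a b′ c (a + suc b) ≡⟨ agree (second<n top≤n) ⟨
    blockSwap a b c (a + suc b)  ≡⟨ blockSwap-second-start ⟩
    a                            ∎)
  where open ≡-Reasoning

blockSwap-params-unique : ∀ {n a b c a′ b′ c′} → a + suc b + suc c ≤ n → a′ + suc b′ + suc c′ ≤ n →
                          AgreeBelow n (blockSwap a b c) (blockSwap a′ b′ c′) →
                          (a , b , c) ≡ (a′ , b′ , c′)
blockSwap-params-unique {n} {a} {b} {c} {a′} {b′} {c′} top≤n top′≤n agree
  with refl ← ≤-antisym (blockSwap-agree⇒start-≤ top′≤n (sym ∘ agree))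
                        (blockSwap-agree⇒start-≤ top≤n agree)
  with refl ← +-cancelˡ-≡ a (suc c) (suc c′)
                (trans (sym blockSwap-start) (trans (agree (start<n top≤n)) blockSwap-start))
  with refl ← ≤-antisym (blockSwap-agree⇒left-≤ top′≤n (sym ∘ agree))
                        (blockSwap-agree⇒left-≤ top≤n agree) = refl

-- Classification of biGrassmannian functions

module TwoDescents {n f g} (inv : Inverses n f g) (onef : AtMostOneDescent f n) (oneg : AtMostOneDescent g n)
                   {d} (sd<n : suc d < n) (descf : Descent f d) {v} (sv<n : suc v < n) (descg : Descent g v) where
  open Inverses inv
  private
    module OnF = WithDescent inv onef sd<n descf
    module OnG = WithDescent (Inverses-sym inv) oneg sv<n descg
    d<n = <-trans (n<1+n d) sd<n
    v<n = <-trans (n<1+n v) sv<n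

  gsv≤d : g (suc v) ≤ d
  gsv≤d = proj₁ (OnF.descent-straddles sv<n descg)

  d<gv : d < g v
  d<gv = proj₂ (OnF.descent-straddles sv<n descg)

  fixed-below : ∀ {p} → p < g (suc v) → f p ≡ p
  fixed-below {p} p<gsv =
    prefix-fixed inv (<-trans p<d+1 sd<n) (OnF.ascending-before (≤-pred p<d+1)) (OnG.ascending-before fp≤v)
    where
    p<d+1 = <-≤-trans p<gsv (m≤n⇒m≤1+n gsv≤d)
    fp≤v : f p ≤ v
    fp≤v = ≤-pred (subst (f p <_) (f∘g sv<n) (ascending-strict p<gsv (OnF.ascending-before gsv≤d)))

  fixed-above : ∀ {p} → g v < p → p < n → f p ≡ p
  fixed-above {p} gv<p p<n =
    suffix-fixed inv p<n (OnF.ascending-after d<p (pred<n p<n)) (OnG.ascending-after v<fp (pred<n p<n))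
    where
    d<p = <-trans d<gv gv<p
    v<fp : v < f p
    v<fp = subst (_< f p) (f∘g v<n) (ascending-strict gv<p (OnF.ascending-after d<gv p<n))

  left-block : ∀ {t} → g (suc v) + t ≤ d → f (g (suc v) + t) ≡ suc v + t
  left-block {t} le = trans (translation inv t a+t<n (OnF.ascending-before le) (OnG.ascending-after v<fa (f-< a+t<n)))
                            (cong (_+ t) (f∘g sv<n))
    where
    a+t<n = ≤-<-trans le d<n
    v<fa = subst (v <_) (sym (f∘g sv<n)) (n<1+n v)

  right-block : ∀ {t} → suc d + t ≤ g v → f (suc d + t) ≡ f (suc d) + t
  right-block {t} le = translation inv t q<n (OnF.ascending-after ≤-refl q<n) (OnG.ascending-before fq≤v)
    where
    q<n = ≤-<-trans le (g-< v<n)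
    fq≤v : f (suc d + t) ≤ v
    fq≤v = subst (f (suc d + t) ≤_) (f∘g v<n)
                 (ascending-mono le (OnF.ascending-after (s≤s (m≤m+n d t)) (g-< v<n)))

  jump-below-start : f (suc d) < g (suc v) → ⊥
  jump-below-start fsd<gsv =
    <-irrefl refl (<-trans (n<1+n d) (<-≤-trans (subst (_< g (suc v)) fsd≡sd fsd<gsv) gsv≤d))
    where
    fsd≡sd : f (suc d) ≡ suc d
    fsd≡sd = f-injective inv (f-< sd<n) sd<n (fixed-below fsd<gsv)

module _ {n f g} (inv : Inverses n f g) (onef : AtMostOneDescent f n) (oneg : AtMostOneDescent g n)
         {d} (sd<n : suc d < n) (descf : Descent f d) {v} (sv<n : suc v < n) (descg : Descent g v) where
  open Inverses inv
  open TwoDescents inv onef oneg sd<n descf sv<n descg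

  jump-lands-on-start : f (suc d) ≡ g (suc v)
  jump-lands-on-start with <-cmp (f (suc d)) (g (suc v))
  ... | tri< fsd<gsv _ _ = ⊥-elim (jump-below-start fsd<gsv)
  ... | tri≈ _ fsd≡gsv _ = fsd≡gsv
  ... | tri> _ _ gsv<fsd =
    ⊥-elim (TwoDescents.jump-below-start (Inverses-sym inv) oneg onef sv<n descg sd<n descf gsv<fsd)

  two-descents⇒blockSwap : ∃[ a ] ∃[ b ] ∃[ c ] a + suc b + suc c ≤ n × AgreeBelow n f (blockSwap a b c)
  two-descents⇒blockSwap = a , b , c , subst (_≤ n) (sym top≡sgv) (g-< v<n) , agree
    where
    v<n = <-trans (n<1+n v) sv<n
    a = g (suc v)
    b = d ∸ a
    c = g v ∸ suc d
    a+b≡d : a + b ≡ d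
    a+b≡d = m+[n∸m]≡n gsv≤d
    sd+c≡gv : suc d + c ≡ g v
    sd+c≡gv = m+[n∸m]≡n d<gv
    a+sb≡sd : a + suc b ≡ suc d
    a+sb≡sd = trans (+-suc a b) (cong suc a+b≡d)
    top≡sgv : a + suc b + suc c ≡ suc (g v)
    top≡sgv = trans (cong (_+ suc c) a+sb≡sd) (trans (+-suc (suc d) c) (cong suc sd+c≡gv))
    v≡a+c : v ≡ a + c
    v≡a+c = begin
      v                ≡⟨ f∘g v<n ⟨
      f (g v)          ≡⟨ cong f sd+c≡gv ⟨
      f (suc d + c)    ≡⟨ right-block (≤-reflexive sd+c≡gv) ⟩
      f (suc d) + c    ≡⟨ cong (_+ c) jump-lands-on-start ⟩
      a + c            ∎
      where open ≡-Reasoning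
    agree : AgreeBelow n f (blockSwap a b c)
    agree {p} p<n with region {a} {b} {c} p
    ... | below p<a = trans (fixed-below p<a) (sym (blockSwap-below p<a))
    ... | first {i} i≤b = begin
      f (a + i)            ≡⟨ left-block (subst (a + i ≤_) a+b≡d (+-monoʳ-≤ a i≤b)) ⟩
      suc v + i            ≡⟨ cong (λ x → suc x + i) v≡a+c ⟩
      suc (a + c) + i      ≡⟨ cong (_+ i) (+-suc a c) ⟨
      a + suc c + i        ≡⟨ xy∙z≈xz∙y a (suc c) i ⟩
      a + i + suc c        ≡⟨ blockSwap-first i≤b ⟨
      blockSwap a b c (a + i) ∎
      where open ≡-Reasoning
    ... | second {j} j≤c = begin
      f (a + suc b + j)    ≡⟨ cong (λ x → f (x + j)) a+sb≡sd ⟩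
      f (suc d + j)        ≡⟨ right-block (subst (suc d + j ≤_) sd+c≡gv (+-monoʳ-≤ (suc d) j≤c)) ⟩
      f (suc d) + j        ≡⟨ cong (_+ j) jump-lands-on-start ⟩
      a + j                ≡⟨ blockSwap-second j≤c ⟨
      blockSwap a b c (a + suc b + j) ∎
      where open ≡-Reasoning
    ... | above top≤p = trans (fixed-above (subst (_≤ p) top≡sgv top≤p) p<n) (sym (blockSwap-above top≤p))

biGrassmannian-classification : ∀ {n f g} → Inverses n f g → AtMostOneDescent f n → AtMostOneDescent g n →
  AgreeBelow n f id ⊎ ∃[ a ] ∃[ b ] ∃[ c ] a + suc b + suc c ≤ n × AgreeBelow n f (blockSwap a b c)
biGrassmannian-classification {n} {f} inv onef oneg
  with anyUpTo? (λ d → suc d <? n ×-dec f (suc d) <? f d) n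
... | no no-descent = inj₁ (ascending⇒identity inv λ {e} _ e<pn →
        let se<n = <pred⇒suc< e<pn in
        ascent-unless-descent inv se<n λ desc → no-descent (e , <-trans (n<1+n e) se<n , se<n , desc))
... | yes (d , _ , sd<n , descf)
  with v , _ , v<fd , descg ← inverse-descent inv (n<1+n d) sd<n descf
  = inj₂ (two-descents⇒blockSwap inv onef oneg sd<n descf sv<n descg)
  where sv<n = ≤-<-trans v<fd (Inverses.f-< inv (<-trans (n<1+n d) sd<n))

-- Permutations in one-line notation

-- Positions outside the list read as 0.
entry : List ℕ → ℕ → ℕ
entry []       _       = 0
entry (x ∷ xs) zero    = x
entry (x ∷ xs) (suc i) = entry xs i

entries : ∀ {n k} → Vec (Fin n) k → List ℕ
entries v = map toℕ (toList v)

⟦_⟧ : ∀ {n k} → Vec (Fin n) k → ℕ → ℕ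
⟦ v ⟧ = entry (entries v)

length-entries : ∀ {n k} (v : Vec (Fin n) k) → length (entries v) ≡ k
length-entries v = trans (length-map toℕ (toList v)) (VP.length-toList v)

⟦⟧-lookup : ∀ {n k} (v : Vec (Fin n) k) i → ⟦ v ⟧ (toℕ i) ≡ toℕ (lookup v i)
⟦⟧-lookup (x ∷ v) F.zero    = refl
⟦⟧-lookup (x ∷ v) (F.suc i) = ⟦⟧-lookup v i

⟦⟧-fromℕ< : ∀ {n k} (v : Vec (Fin n) k) {p} (p<k : p < k) → ⟦ v ⟧ p ≡ toℕ (lookup v (fromℕ< p<k))
⟦⟧-fromℕ< v p<k = trans (cong ⟦ v ⟧ (sym (FP.toℕ-fromℕ< p<k))) (⟦⟧-lookup v (fromℕ< p<k))

⟦⟧-< : ∀ {n k} (v : Vec (Fin n) k) {p} → p < k → ⟦ v ⟧ p < n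
⟦⟧-< v p<k rewrite ⟦⟧-fromℕ< v p<k = FP.toℕ<n _

descentsℕ-ascent : ∀ {x y} xs → ¬ y < x → descentsℕ (x ∷ y ∷ xs) ≡ descentsℕ (y ∷ xs)
descentsℕ-ascent _ y≮x rewrite ≤⇒<ᵇ≡false (≮⇒≥ y≮x) = refl

descentsℕ-descent : ∀ {x y} xs → y < x → descentsℕ (x ∷ y ∷ xs) ≡ suc (descentsℕ (y ∷ xs))
descentsℕ-descent _ y<x rewrite <⇒<ᵇ≡true y<x = refl

no-descent⇒descentsℕ≡0 : ∀ w → (∀ {i} → suc i < length w → ¬ Descent (entry w) i) → descentsℕ w ≡ 0
no-descent⇒descentsℕ≡0 []           _    = refl
no-descent⇒descentsℕ≡0 (x ∷ [])     _    = refl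
no-descent⇒descentsℕ≡0 (x ∷ y ∷ xs) none =
  trans (descentsℕ-ascent xs (none {0} (s≤s (s≤s z≤n)))) (no-descent⇒descentsℕ≡0 (y ∷ xs) (none ∘ s≤s))

descentsℕ≡0⇒no-descent : ∀ w → descentsℕ w ≡ 0 → ∀ {i} → suc i < length w → ¬ Descent (entry w) i
descentsℕ≡0⇒no-descent (x ∷ [])     _     {_}     (s≤s ())
descentsℕ≡0⇒no-descent (x ∷ y ∷ xs) zero≡ {zero}  _ y<x
  with () ← trans (sym (descentsℕ-descent xs y<x)) zero≡
descentsℕ≡0⇒no-descent (x ∷ y ∷ xs) zero≡ {suc i} (s≤s si<l) =
  descentsℕ≡0⇒no-descent (y ∷ xs) (m+n≡0⇒n≡0 (if y <ᵇ x then 1 else 0) zero≡) si<l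

descentsℕ≤1⇒one-descent : ∀ w → descentsℕ w ≤ 1 → AtMostOneDescent (entry w) (length w)
descentsℕ≤1⇒one-descent (x ∷ y ∷ xs) ≤1 {zero} {suc j} _ (s≤s sj<l) y<x =
  descentsℕ≡0⇒no-descent (y ∷ xs) (n≤0⇒n≡0 (≤-pred (subst (_≤ 1) (descentsℕ-descent xs y<x) ≤1))) sj<l
descentsℕ≤1⇒one-descent (x ∷ y ∷ xs) ≤1 {suc i} {suc j} (s≤s i<j) (s≤s sj<l) =
  descentsℕ≤1⇒one-descent (y ∷ xs) (m+n≤o⇒n≤o (if y <ᵇ x then 1 else 0) ≤1) i<j sj<l

one-descent⇒descentsℕ≤1 : ∀ w → AtMostOneDescent (entry w) (length w) → descentsℕ w ≤ 1
one-descent⇒descentsℕ≤1 []           _   = z≤n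
one-descent⇒descentsℕ≤1 (x ∷ [])     _   = z≤n
one-descent⇒descentsℕ≤1 (x ∷ y ∷ xs) one =
  step (y <? x) (one-descent⇒descentsℕ≤1 (y ∷ xs) λ i<j sj<l → one (s≤s i<j) (s≤s sj<l))
  where
  step : Dec (y < x) → descentsℕ (y ∷ xs) ≤ 1 → descentsℕ (x ∷ y ∷ xs) ≤ 1
  step (yes y<x) _ = ≤-reflexive (trans (descentsℕ-descent xs y<x)
                       (cong suc (no-descent⇒descentsℕ≡0 (y ∷ xs) λ si<l → one {0} (s≤s z≤n) (s≤s si<l) y<x)))
  step (no y≮x) ≤1 = subst (_≤ 1) (sym (descentsℕ-ascent xs y≮x)) ≤1

grassmannian⇔one-descent : ∀ {n} (v : Vec (Fin n) n) → IsGrassmannian v ⇔ AtMostOneDescent ⟦ v ⟧ n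
grassmannian⇔one-descent v = mk⇔ to from
  where
  to : IsGrassmannian v → AtMostOneDescent ⟦ v ⟧ _
  to ≤1 = subst (AtMostOneDescent ⟦ v ⟧) (length-entries v) (descentsℕ≤1⇒one-descent (entries v) ≤1)
  from : AtMostOneDescent ⟦ v ⟧ _ → IsGrassmannian v
  from one = one-descent⇒descentsℕ≤1 (entries v) (subst (AtMostOneDescent ⟦ v ⟧) (sym (length-entries v)) one)

LookupInjective : ∀ {A : Set} {k} → Vec A k → Set
LookupInjective v = ∀ {i j} → lookup v i ≡ lookup v j → i ≡ j

private
  All-lookup : ∀ {A : Set} {P : A → Set} {k} (v : Vec A k) → All P (toList v) → ∀ i → P (lookup v i)
  All-lookup (x ∷ v) (px ∷ _)   F.zero    = px
  All-lookup (x ∷ v) (_  ∷ pxs) (F.suc i) = All-lookup v pxs i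

  lookup-All : ∀ {A : Set} {P : A → Set} {k} (v : Vec A k) → (∀ i → P (lookup v i)) → All P (toList v)
  lookup-All []      _  = []
  lookup-All (x ∷ v) pv = pv F.zero ∷ lookup-All v (pv ∘ F.suc)

unique⇒lookup-injective : ∀ {A : Set} {k} (v : Vec A k) → Unique (toList v) → LookupInjective v
unique⇒lookup-injective (x ∷ v) (x∉ ∷ u) {F.zero}  {F.zero}  _  = refl
unique⇒lookup-injective (x ∷ v) (x∉ ∷ u) {F.zero}  {F.suc j} eq = ⊥-elim (All-lookup v x∉ j eq)
unique⇒lookup-injective (x ∷ v) (x∉ ∷ u) {F.suc i} {F.zero}  eq = ⊥-elim (All-lookup v x∉ i (sym eq))
unique⇒lookup-injective (x ∷ v) (x∉ ∷ u) {F.suc i} {F.suc j} eq = cong F.suc (unique⇒lookup-injective v u eq)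

lookup-injective⇒unique : ∀ {A : Set} {k} (v : Vec A k) → LookupInjective v → Unique (toList v)
lookup-injective⇒unique []      _   = []
lookup-injective⇒unique (x ∷ v) inj =
  lookup-All v (λ i eq → FP.0≢1+n (inj eq)) ∷ lookup-injective⇒unique v (FP.suc-injective ∘ inj)

position-just : ∀ {n k} (v : Vec (Fin n) k) {j p} → position v j ≡ just p → lookup v p ≡ j
position-just (x ∷ v) {j} eq with x F.≟ j
position-just (x ∷ v) refl | yes x≡j = x≡j
position-just (x ∷ v) {j} eq | no _ with position v j in eq′
position-just (x ∷ v) refl | no _ | just q = position-just v eq′

position-nothing : ∀ {n k} (v : Vec (Fin n) k) {j} → position v j ≡ nothing → ∀ i → lookup v i ≢ j
position-nothing (x ∷ v) {j} eq i with x F.≟ j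
position-nothing (x ∷ v) () i | yes _
position-nothing (x ∷ v) {j} eq i | no x≢j with position v j in eq′
position-nothing (x ∷ v) refl F.zero    | no x≢j | nothing = x≢j
position-nothing (x ∷ v) refl (F.suc i) | no x≢j | nothing = position-nothing v eq′ i

-- If j were missing, punching it out of the values of v would inject Fin (suc m) into Fin m.
lookup-injective⇒position-just : ∀ {n} (v : Vec (Fin n) n) → LookupInjective v →
                                 ∀ j → ∃[ p ] position v j ≡ just p
lookup-injective⇒position-just {suc m} v inj j with position v j in eq
... | just p  = p , refl
... | nothing = ⊥-elim (<-irrefl refl (FP.injective⇒≤ {f = squeeze} squeeze-injective))
  where
  squeeze : Fin (suc m) → Fin m
  j≢ : ∀ i → j ≢ lookup v i
  j≢ i = position-nothing v eq i ∘ sym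
  squeeze i = F.punchOut (j≢ i)
  squeeze-injective : ∀ {x y} → squeeze x ≡ squeeze y → x ≡ y
  squeeze-injective {x} {y} eq = inj (FP.punchOut-injective (j≢ x) (j≢ y) eq)

module _ {n} (v : Vec (Fin n) n) (inj : LookupInjective v) where

  lookup-inverseʳ : ∀ j → lookup v (lookup (inverse v) j) ≡ j
  lookup-inverseʳ j with p , eq ← lookup-injective⇒position-just v inj j
    rewrite VP.lookup∘tabulate (λ j → fromMaybe j (position v j)) j | eq = position-just v eq

  lookup-inverseˡ : ∀ i → lookup (inverse v) (lookup v i) ≡ i
  lookup-inverseˡ i = inj (lookup-inverseʳ (lookup v i))

⟦⟧-∘ : ∀ {n} (u w : Vec (Fin n) n) → (∀ j → lookup u (lookup w j) ≡ j) →
       ∀ {j} → j < n → ⟦ u ⟧ (⟦ w ⟧ j) ≡ j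
⟦⟧-∘ u w uw {j} j<n = begin
  ⟦ u ⟧ (⟦ w ⟧ j)                 ≡⟨ cong ⟦ u ⟧ (⟦⟧-fromℕ< w j<n) ⟩
  ⟦ u ⟧ (toℕ (lookup w jᶠ))       ≡⟨ ⟦⟧-lookup u (lookup w jᶠ) ⟩
  toℕ (lookup u (lookup w jᶠ))    ≡⟨ cong toℕ (uw jᶠ) ⟩
  toℕ jᶠ                          ≡⟨ FP.toℕ-fromℕ< j<n ⟩
  j                               ∎
  where
  jᶠ = fromℕ< j<n
  open ≡-Reasoning

⟦⟧-inverses : ∀ {n} (v : Vec (Fin n) n) → LookupInjective v → Inverses n ⟦ v ⟧ ⟦ inverse v ⟧
⟦⟧-inverses v inj = record
  { f-< = ⟦⟧-< v
  ; g-< = ⟦⟧-< (inverse v)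
  ; f∘g = ⟦⟧-∘ v (inverse v) (lookup-inverseʳ v inj)
  ; g∘f = ⟦⟧-∘ (inverse v) v (lookup-inverseˡ v inj)
  }

contains2413⇔pattern2413 : ∀ {n} (v : Vec (Fin n) n) → Contains2413 v ⇔ Pattern2413 ⟦ v ⟧ n
contains2413⇔pattern2413 {n} v = mk⇔ to from
  where
  to : Contains2413 v → Pattern2413 ⟦ v ⟧ n
  to (i , j , k , l , i<j , j<k , k<l , vk<vi , vi<vl , vl<vj) =
    toℕ i , toℕ j , toℕ k , toℕ l , i<j , j<k , k<l , FP.toℕ<n l ,
    entry-< k i vk<vi , entry-< i l vi<vl , entry-< l j vl<vj
    where
    entry-< : ∀ x y → lookup v x F.< lookup v y → ⟦ v ⟧ (toℕ x) < ⟦ v ⟧ (toℕ y)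
    entry-< x y = subst₂ _<_ (sym (⟦⟧-lookup v x)) (sym (⟦⟧-lookup v y))
  from : Pattern2413 ⟦ v ⟧ n → Contains2413 v
  from (i , j , k , l , i<j , j<k , k<l , l<n , vk<vi , vi<vl , vl<vj) =
    fromℕ< i<n , fromℕ< j<n , fromℕ< k<n , fromℕ< l<n ,
    fromℕ<-mono-< i<n j<n i<j , fromℕ<-mono-< j<n k<n j<k , fromℕ<-mono-< k<n l<n k<l ,
    lookup-< k<n i<n vk<vi , lookup-< i<n l<n vi<vl , lookup-< l<n j<n vl<vj
    where
    k<n = <-trans k<l l<n
    j<n = <-trans j<k k<n
    i<n = <-trans i<j j<n
    fromℕ<-mono-< : ∀ {p q} (p<n : p < n) (q<n : q < n) → p < q → fromℕ< p<n F.< fromℕ< q<n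
    fromℕ<-mono-< p<n q<n = subst₂ _<_ (sym (FP.toℕ-fromℕ< p<n)) (sym (FP.toℕ-fromℕ< q<n))
    lookup-< : ∀ {p q} (p<n : p < n) (q<n : q < n) →
               ⟦ v ⟧ p < ⟦ v ⟧ q → lookup v (fromℕ< p<n) F.< lookup v (fromℕ< q<n)
    lookup-< p<n q<n = subst₂ _<_ (⟦⟧-fromℕ< v p<n) (⟦⟧-fromℕ< v q<n)

fromℕ-or : ∀ {n} → Fin n → ℕ → Fin n
fromℕ-or {n} default p with p <? n
... | yes p<n = fromℕ< p<n
... | no _    = default

toℕ-fromℕ-or : ∀ {n} (default : Fin n) {p} → p < n → toℕ (fromℕ-or default p) ≡ p
toℕ-fromℕ-or {n} default {p} p<n with p <? n
... | yes p<n′ = FP.toℕ-fromℕ< p<n′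
... | no p≮n   = ⊥-elim (p≮n p<n)

tabulateℕ : ∀ n → (ℕ → ℕ) → Vec (Fin n) n
tabulateℕ n h = tabulate (λ i → fromℕ-or i (h (toℕ i)))

⟦tabulateℕ⟧ : ∀ {n h} → (∀ {p} → p < n → h p < n) → AgreeBelow n ⟦ tabulateℕ n h ⟧ h
⟦tabulateℕ⟧ {n} {h} h-< {p} p<n = begin
  ⟦ tabulateℕ n h ⟧ p                      ≡⟨ ⟦⟧-fromℕ< (tabulateℕ n h) p<n ⟩
  toℕ (lookup (tabulateℕ n h) P)          ≡⟨ cong toℕ (VP.lookup∘tabulate _ P) ⟩
  toℕ (fromℕ-or P (h (toℕ P)))            ≡⟨ toℕ-fromℕ-or P (h-< (FP.toℕ<n P)) ⟩
  h (toℕ P)                               ≡⟨ cong h (FP.toℕ-fromℕ< p<n) ⟩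
  h p                                     ∎
  where
  P = fromℕ< p<n
  open ≡-Reasoning

≡-tabulateℕ : ∀ {n h} (v : Vec (Fin n) n) → AgreeBelow n ⟦ v ⟧ h → v ≡ tabulateℕ n h
≡-tabulateℕ {n} {h} v agree =
  trans (sym (VP.tabulate∘lookup v)) (VP.tabulate-cong λ i → FP.toℕ-injective (entry-eq i))
  where
  open ≡-Reasoning
  entry-eq : ∀ i → toℕ (lookup v i) ≡ toℕ (fromℕ-or i (h (toℕ i)))
  entry-eq i = begin
    toℕ (lookup v i)               ≡⟨ ⟦⟧-lookup v i ⟨
    ⟦ v ⟧ (toℕ i)                  ≡⟨ agree (FP.toℕ<n i) ⟩
    h (toℕ i)                      ≡⟨ toℕ-fromℕ-or i (subst (_< n) (agree i<n) (⟦⟧-< v i<n)) ⟨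
    toℕ (fromℕ-or i (h (toℕ i)))   ∎
    where i<n = FP.toℕ<n i

-- Enumerations

module _ {A : Set} where

  allWords-cartesian : ∀ (xs : List A) k → allWords xs (suc k) ≡ cartesianProductWith _∷_ xs (allWords xs k)
  allWords-cartesian xs k = go xs
    where
    go : ∀ ys → concatMap (λ y → map (y ∷_) (allWords xs k)) ys
              ≡ cartesianProductWith _∷_ ys (allWords xs k)
    go []       = refl
    go (y ∷ ys) = cong (map (y ∷_) (allWords xs k) ++_) (go ys)

  allWords-unique : ∀ {xs : List A} → Unique xs → ∀ k → Unique (allWords xs k)
  allWords-unique u zero    = All.[] ∷ []
  allWords-unique {xs} u (suc k) rewrite allWords-cartesian xs k =
    Unique.cartesianProductWith⁺ _∷_ VP.∷-injective u (allWords-unique u k)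

  ∈-allWords : ∀ {xs : List A} → (∀ x → x ∈ xs) → ∀ {k} (w : Vec A k) → w ∈ allWords xs k
  ∈-allWords every [] = here refl
  ∈-allWords {xs} every {suc k} (x ∷ w) rewrite allWords-cartesian xs k =
    ∈-cartesianProductWith⁺ _∷_ (every x) (∈-allWords every w)

allVecs-unique : ∀ n → Unique (allVecs n)
allVecs-unique n = allWords-unique (Unique.allFin⁺ n) n

∈-allVecs : ∀ {n} (v : Vec _ n) → v ∈ allVecs n
∈-allVecs v = ∈-allWords ∈-allFin v

module _ {A : Set} where

  layer : List (ℕ × A) → List A → List (ℕ × A)
  layer L M = map (map₁ suc) L ++ map (0 ,_) M

  ∈-layer-zero : ∀ {L M x} → (0 , x) ∈ layer L M ⇔ x ∈ M
  ∈-layer-zero {L} {M} = mk⇔ from (∈-++⁺ʳ (map (map₁ suc) L) ∘ ∈-map⁺ (0 ,_))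
    where
    from : ∀ {x} → (0 , x) ∈ layer L M → x ∈ M
    from mem with ∈-++⁻ (map (map₁ suc) L) mem
    ... | inj₁ mem₁ with _ , _ , () ← ∈-map⁻ (map₁ suc) mem₁
    ... | inj₂ mem₂ with _ , mem , refl ← ∈-map⁻ (0 ,_) mem₂ = mem

  ∈-layer-suc : ∀ {L M a x} → (suc a , x) ∈ layer L M ⇔ (a , x) ∈ L
  ∈-layer-suc {L} {M} = mk⇔ from (∈-++⁺ˡ ∘ ∈-map⁺ (map₁ suc))
    where
    from : ∀ {a x} → (suc a , x) ∈ layer L M → (a , x) ∈ L
    from mem with ∈-++⁻ (map (map₁ suc) L) mem
    ... | inj₁ mem₁ with _ , mem , refl ← ∈-map⁻ (map₁ suc) mem₁ = mem
    ... | inj₂ mem₂ with _ , _ , () ← ∈-map⁻ (0 ,_) mem₂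

  layer-unique : ∀ {L M} → Unique L → Unique M → Unique (layer L M)
  layer-unique {L} {M} uL uM =
    Unique.++⁺ (Unique.map⁺ suc-injective′ uL) (Unique.map⁺ zero-injective uM) disjoint
    where
    suc-injective′ : ∀ {p q : ℕ × A} → map₁ suc p ≡ map₁ suc q → p ≡ q
    suc-injective′ {_ , _} {_ , _} refl = refl
    zero-injective : ∀ {x y : A} → (0 , x) ≡ (0 , y) → x ≡ y
    zero-injective refl = refl
    disjoint : ∀ {p} → p ∈ map (map₁ suc) L × p ∈ map (0 ,_) M → ⊥
    disjoint (mem₁ , mem₂)
      with _ , _ , refl ← ∈-map⁻ (map₁ suc) mem₁ with _ , _ , () ← ∈-map⁻ (0 ,_) mem₂

  length-layer : ∀ L M → length (layer L M) ≡ length L + length M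
  length-layer L M = trans (length-++ (map (map₁ suc) L)) (cong₂ _+_ (length-map _ L) (length-map _ M))

pairs : ℕ → List (ℕ × ℕ)
pairs zero    = []
pairs (suc n) = layer (pairs n) (upTo n)

triples : ℕ → List (ℕ × ℕ × ℕ)
triples zero    = []
triples (suc n) = layer (triples n) (pairs (suc n))

∈-pairs : ∀ {n b c} → (b , c) ∈ pairs n ⇔ suc b + suc c ≤ n
∈-pairs {zero} = mk⇔ (λ ()) (λ ())
∈-pairs {suc n} {zero}  = mk⇔ (s≤s ∘ ∈-upTo⁻ ∘ Equivalence.to ∈-layer-zero)
                              (Equivalence.from ∈-layer-zero ∘ ∈-upTo⁺ ∘ ≤-pred)
∈-pairs {suc n} {suc b} = mk⇔ (s≤s ∘ Equivalence.to ∈-pairs ∘ Equivalence.to ∈-layer-suc)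
                              (Equivalence.from ∈-layer-suc ∘ Equivalence.from ∈-pairs ∘ ≤-pred)

∈-triples : ∀ {n a b c} → (a , b , c) ∈ triples n ⇔ a + suc b + suc c ≤ n
∈-triples {zero} {a} {b} = mk⇔ (λ ()) (λ top≤0 → contradiction (m+n≤o⇒n≤o (a + suc b) top≤0) λ ())
∈-triples {suc n} {zero}  = mk⇔ (Equivalence.to ∈-pairs ∘ Equivalence.to ∈-layer-zero)
                                (Equivalence.from ∈-layer-zero ∘ Equivalence.from ∈-pairs)
∈-triples {suc n} {suc a} = mk⇔ (s≤s ∘ Equivalence.to ∈-triples ∘ Equivalence.to ∈-layer-suc)
                                (Equivalence.from ∈-layer-suc ∘ Equivalence.from ∈-triples ∘ ≤-pred)

pairs-unique : ∀ n → Unique (pairs n)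
pairs-unique zero    = []
pairs-unique (suc n) = layer-unique (pairs-unique n) (Unique.upTo⁺ n)

triples-unique : ∀ n → Unique (triples n)
triples-unique zero    = []
triples-unique (suc n) = layer-unique (triples-unique n) (pairs-unique (suc n))

length-pairs : ∀ n → length (pairs n) ≡ n C 2
length-pairs zero    = refl
length-pairs (suc n) = begin
  length (layer (pairs n) (upTo n))  ≡⟨ length-layer (pairs n) (upTo n) ⟩
  length (pairs n) + length (upTo n) ≡⟨ cong₂ _+_ (length-pairs n) (length-upTo n) ⟩
  n C 2 + n                          ≡⟨ +-comm (n C 2) n ⟩
  n + n C 2                          ≡⟨ cong (_+ n C 2) (nC1≡n n) ⟨
  n C 1 + n C 2                      ≡⟨ nCk+nC[k+1]≡[n+1]C[k+1] n 1 ⟩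
  suc n C 2                          ∎
  where open ≡-Reasoning

length-triples : ∀ n → length (triples n) ≡ suc n C 3
length-triples zero    = refl
length-triples (suc n) = begin
  length (layer (triples n) (pairs (suc n)))      ≡⟨ length-layer (triples n) (pairs (suc n)) ⟩
  length (triples n) + length (pairs (suc n))     ≡⟨ cong₂ _+_ (length-triples n) (length-pairs (suc n)) ⟩
  suc n C 3 + suc n C 2                           ≡⟨ +-comm (suc n C 3) (suc n C 2) ⟩
  suc n C 2 + suc n C 3                           ≡⟨ nCk+nC[k+1]≡[n+1]C[k+1] (suc n) 2 ⟩
  suc (suc n) C 3                                 ∎
  where open ≡-Reasoning

unique-map⁺ : ∀ {A B : Set} {f : A → B} {xs} → (∀ {x y} → x ∈ xs → y ∈ xs → f x ≡ f y → x ≡ y) →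
              Unique xs → Unique (map f xs)
unique-map⁺ {xs = []}     _   []         = []
unique-map⁺ {xs = x ∷ xs} inj (x∉ ∷ u) =
  All.map⁺ (All.tabulate λ y∈xs fx≡fy → All.lookup x∉ y∈xs (inj (here refl) (there y∈xs) fx≡fy))
  ∷ unique-map⁺ (λ x∈ y∈ → inj (there x∈) (there y∈)) u

grassmannian⁻¹⇔avoids2413 : ∀ {n} (π : Vec (Fin n) n) → IsPerm π → IsGrassmannian π →
                            IsGrassmannian (inverse π) ⇔ Avoids2413 π
grassmannian⁻¹⇔avoids2413 π perm grass =
  ⇔-trans (grassmannian⇔one-descent (inverse π))
  (⇔-trans (one-descent⁻¹⇔avoids2413 (⟦⟧-inverses π (unique⇒lookup-injective π perm))
                                       (Equivalence.to (grassmannian⇔one-descent π) grass))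
           (¬-cong-⇔ (⇔-sym (contains2413⇔pattern2413 π))))

identity-inverses : ∀ {n} → Inverses n id id
identity-inverses = record { f-< = id ; g-< = id ; f∘g = λ _ → refl ; g∘f = λ _ → refl }

identity-one-descent : ∀ {n} → AtMostOneDescent id n
identity-one-descent _ _ desc _ = <-asym desc (n<1+n _)

tabulateℕ-injective : ∀ {n h h′} → (∀ {p} → p < n → h p < n) → (∀ {p} → p < n → h′ p < n) →
                      tabulateℕ n h ≡ tabulateℕ n h′ → AgreeBelow n h h′
tabulateℕ-injective h-< h′-< eq {p} p<n =
  trans (sym (⟦tabulateℕ⟧ h-< p<n)) (trans (cong (λ w → ⟦ w ⟧ p) eq) (⟦tabulateℕ⟧ h′-< p<n))

tabulateℕ-biGrassmannian : ∀ {n h h′} → Inverses n h h′ → AtMostOneDescent h n → AtMostOneDescent h′ n →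
                           IsPermBiGrassmannian (tabulateℕ n h)
tabulateℕ-biGrassmannian {n} {h} {h′} inv one one′ =
  lookup-injective⇒unique v inj ,
  Equivalence.from (grassmannian⇔one-descent v) (AtMostOneDescent-cong (sym ∘ v≗h) one) ,
  Equivalence.from (grassmannian⇔one-descent (inverse v)) (AtMostOneDescent-cong (sym ∘ v⁻¹≗h′) one′)
  where
  open Inverses inv
  v = tabulateℕ n h
  v≗h : AgreeBelow n ⟦ v ⟧ h
  v≗h = ⟦tabulateℕ⟧ f-<
  inj : LookupInjective v
  inj {i} {j} eq = FP.toℕ-injective (f-injective inv (FP.toℕ<n i) (FP.toℕ<n j) (begin
    h (toℕ i)               ≡⟨ v≗h (FP.toℕ<n i) ⟨
    ⟦ v ⟧ (toℕ i)           ≡⟨ ⟦⟧-lookup v i ⟩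
    toℕ (lookup v i)        ≡⟨ cong toℕ eq ⟩
    toℕ (lookup v j)        ≡⟨ ⟦⟧-lookup v j ⟨
    ⟦ v ⟧ (toℕ j)           ≡⟨ v≗h (FP.toℕ<n j) ⟩
    h (toℕ j)               ∎))
    where open ≡-Reasoning
  v⁻¹≗h′ : AgreeBelow n ⟦ inverse v ⟧ h′
  v⁻¹≗h′ {p} p<n = begin
    ⟦ inverse v ⟧ p                ≡⟨ cong ⟦ inverse v ⟧ (f∘g p<n) ⟨
    ⟦ inverse v ⟧ (h (h′ p))       ≡⟨ cong ⟦ inverse v ⟧ (v≗h (g-< p<n)) ⟨
    ⟦ inverse v ⟧ (⟦ v ⟧ (h′ p))   ≡⟨ Inverses.g∘f (⟦⟧-inverses v inj) (g-< p<n) ⟩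
    h′ p                           ∎
    where open ≡-Reasoning

blockSwapVec : ∀ n → ℕ × ℕ × ℕ → Vec (Fin n) n
blockSwapVec n (a , b , c) = tabulateℕ n (blockSwap a b c)

biGrassmannians : ∀ n → List (Vec (Fin n) n)
biGrassmannians n = tabulateℕ n id ∷ map (blockSwapVec n) (triples n)

∈-biGrassmannians : ∀ {n v} → v ∈ filter isPermBiGrassmannian? (allVecs n) ⇔ v ∈ biGrassmannians n
∈-biGrassmannians {n} = mk⇔ to from
  where
  to : ∀ {v} → v ∈ filter isPermBiGrassmannian? (allVecs n) → v ∈ biGrassmannians n
  to {v} mem with _ , perm , grass , grass⁻¹ ← ∈-filter⁻ isPermBiGrassmannian? {xs = allVecs n} mem
    with biGrassmannian-classification (⟦⟧-inverses v (unique⇒lookup-injective v perm))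
           (Equivalence.to (grassmannian⇔one-descent v) grass)
           (Equivalence.to (grassmannian⇔one-descent (inverse v)) grass⁻¹)
  ... | inj₁ v≗id = here (≡-tabulateℕ v v≗id)
  ... | inj₂ (a , b , c , top≤n , v≗swap) =
    there (subst (_∈ _) (sym (≡-tabulateℕ v v≗swap))
                 (∈-map⁺ (blockSwapVec n) (Equivalence.from ∈-triples top≤n)))
  from : ∀ {v} → v ∈ biGrassmannians n → v ∈ filter isPermBiGrassmannian? (allVecs n)
  from (here refl) =
    ∈-filter⁺ isPermBiGrassmannian? (∈-allVecs _)
      (tabulateℕ-biGrassmannian identity-inverses identity-one-descent identity-one-descent)
  from (there mem) with (a , b , c) , mem′ , refl ← ∈-map⁻ (blockSwapVec n) mem =
    ∈-filter⁺ isPermBiGrassmannian? (∈-allVecs _)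
      (tabulateℕ-biGrassmannian (blockSwap-inverses (Equivalence.to ∈-triples mem′))
        (blockSwap-one-descent {a} {b} {c}) (blockSwap-one-descent {a} {c} {b}))

biGrassmannians-unique : ∀ n → Unique (biGrassmannians n)
biGrassmannians-unique n = All.tabulate id≢swap ∷ unique-map⁺ swap-injective (triples-unique n)
  where
  id≢swap : ∀ {v} → v ∈ map (blockSwapVec n) (triples n) → tabulateℕ n id ≢ v
  id≢swap mem eq with (a , b , c) , mem′ , refl ← ∈-map⁻ (blockSwapVec n) mem =
    blockSwap-moves-start {a} {b} {c} (sym (tabulateℕ-injective id (blockSwap-< top≤n) eq (start<n top≤n)))
    where top≤n = Equivalence.to ∈-triples mem′
  swap-injective : ∀ {x y} → x ∈ triples n → y ∈ triples n → blockSwapVec n x ≡ blockSwapVec n y → x ≡ y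
  swap-injective {a , b , c} {a′ , b′ , c′} mem mem′ eq =
    blockSwap-params-unique top≤n top′≤n (tabulateℕ-injective (blockSwap-< top≤n) (blockSwap-< top′≤n) eq)
    where
    top≤n = Equivalence.to ∈-triples mem
    top′≤n = Equivalence.to ∈-triples mem′

count-biGrassmannians : ∀ n → length (filter isPermBiGrassmannian? (allVecs n)) ≡ 1 + (suc n C 3)
count-biGrassmannians n = begin
  length (filter isPermBiGrassmannian? (allVecs n))  ≡⟨ ↭-length (∼bag⇒↭ (unique∧set⇒bag
      (Unique.filter⁺ isPermBiGrassmannian? (allVecs-unique n)) (biGrassmannians-unique n) ∈-biGrassmannians)) ⟩
  length (biGrassmannians n)                         ≡⟨ cong suc (length-map (blockSwapVec n) (triples n)) ⟩
  1 + length (triples n)                             ≡⟨ cong suc (length-triples n) ⟩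
  1 + (suc n C 3)                                    ∎
  where open ≡-Reasoning

mainTheorem1 : (n : ℕ) →
    ((π : Vec (Fin n) n) → IsPerm π → IsGrassmannian π →
      (IsGrassmannian (inverse π) ⇔ Avoids2413 π))
    × (length (filter isPermBiGrassmannian? (allVecs n)) ≡ 1 + (suc n C 3))
mainTheorem1 n = grassmannian⁻¹⇔avoids2413 , count-biGrassmannians n
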